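{- Let $d\ge2$. If a $d$-permutation $\boldsymbol\pi$ avoids the pattern $(21,12)$ and the pattern $231$, then $\boldsymbol\pi$ is admissible with respect to ${\bf C}_F$.
   Context: A $d$-permutation of size $n$ is a tuple $\boldsymbol{\pi}=(\pi_1,\ldots,\pi_{d-1})$ of permutations of $[n]$; put $\pi_0=\mathrm{id}$. Its points are $(i,\pi_1(i),\ldots,\pi_{d-1}(i))$, $i\in[n]$; $\pi_l(p)$ is the $l$-th coordinate of $p$. For distinct points $p,q$, ${\bf dir}(p,q)=(\mathrm{sign}(\pi_0(q)-\pi_0(p)),\ldots,\mathrm{sign}(\pi_{d-1}(q)-\pi_{d-1}(p)))$. $\mathbb{F}^d$ is the set of directions in $\{+1,-1\}^d$ with last entry $-1$. Max-tree $\gamma^d(\boldsymbol\pi)$: a rooted tree in which every node is a leaf or internal with $2^{d-1}$ children labelled by the directions of $\mathbb{F}^d$; empty $\boldsymbol\pi$ gives a leaf; otherwise the root corresponds to the point $p_{\max}$ with $\pi_{d-1}(p_{\max})=n$ and the child labelled ${\bf f}$ is the max-tree of the sub-$d$-permutation of points $p'$ with ${\bf dir}(p_{\max},p')={\bf f}$ (relabelled order-preservingly). Internal nodes correspond to points; $\mathcal{T}_{\bf f}(r)$ is the subtree at the child of $r$ labelled ${\bf f}$. $F=\{{\bf dir}^0,\ldots,{\bf dir}^{d-1}\}$ with ${\bf dir}^i=(+1$ repeated $i$ times, $-1$ repeated $d-i$ times$)$. ${\bf C}_F=(C,\ldots,C)$ ($d$ copies) where $C$ is the total order on $F$ with ${\bf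 dir}^i$ before ${\bf dir}^j$ iff $i<j$. $\boldsymbol\pi$ is admissible with respect to ${\bf C}_F$ if (i) for every internal node $r$ of $\gamma^d(\boldsymbol\pi)$, every $l\in\{0,\ldots,d-1\}$ and all $i<j$, every point of a node of $\mathcal{T}_{{\bf dir}^i}(r)$ has smaller $l$-th coordinate than every point of a node of $\mathcal{T}_{{\bf dir}^j}(r)$; and (ii) there are no internal nodes $r_1,r_2$ with $r_1\in\mathcal{T}_{\bf f}(r_2)$ for some ${\bf f}\in\mathbb{F}^d\setminus F$. Containment of patterns is via direct projections $(\pi_{i_2}\pi_{i_1}^{ -1},\ldots)$ with $i_1<i_2<\cdots$; concretely $\boldsymbol\pi$ contains $(21,12)$ iff there are points $p,q$ and $0\le i<j<k\le d-1$ with $\pi_i(p)<\pi_i(q)$, $\pi_j(p)>\pi_j(q)$, $\pi_k(p)<\pi_k(q)$, and contains $231$ iff there are $0\le i<j\le d-1$ and points $a,b,c$ with $\pi_i(a)<\pi_i(b)<\pi_i(c)$, $\pi_j(c)<\pi_j(a)<\pi_j(b)$. -}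

module Defs where

open import Data.Nat using (ℕ; zero; suc; _<_; _<ᵇ_)
open import Data.Bool using (Bool; true; false; if_then_else_; _∧_)
open import Data.Fin using (Fin; zero; suc; toℕ; fromℕ; _≟_)
  renaming (_<_ to _<ᶠ_)
open import Data.Fin.Permutation using (Permutation′; _⟨$⟩ʳ_)
open import Data.Sign using (Sign; +; -)
import Data.Sign.Properties as SignP
open import Data.Vec using (Vec; tabulate; last)
import Data.Vec.Properties as VecP
open import Data.List using (List; []; _∷_; filter; allFin)
open import Data.Product using (Σ; ∃; ∃-syntax; _×_; _,_; proj₁)
open import Relation.Nullary using (¬_; Dec; yes; no; _×-dec_)
open import Relation.Nullary.Decidable using (⌊_⌋; ¬?)
open import Relation.Binary.PropositionalEquality using (_≡_; _≢_)

-- A d-permutation with d = suc k : a tuple (π₁,…,π_k) of permutations of [n].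
DPerm : ℕ → ℕ → Set
DPerm k n = Fin k → Permutation′ n

-- Points are identified with their 0-th coordinate i ∈ Fin n.
-- coord π l p = π_l(p), with π₀ = id.
coord : ∀ {k n} → DPerm k n → Fin (suc k) → Fin n → Fin n
coord π zero    p = p
coord π (suc l) p = π l ⟨$⟩ʳ p

Dir : ℕ → Set
Dir k = Vec Sign (suc k)

dir : ∀ {k n} → DPerm k n → Fin n → Fin n → Dir k
dir π p q = tabulate λ l → if toℕ (coord π l p) <ᵇ toℕ (coord π l q) then + else -

𝔽 : ℕ → Set
𝔽 k = Σ (Dir k) λ f → last f ≡ -

dirⁱ : ∀ {k} → Fin (suc k) → Dir k
dirⁱ i = tabulate λ l → if toℕ l <ᵇ toℕ i then + else -

InF : ∀ {k} → Dir k → Set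
InF {k} f = ∃[ i ] f ≡ dirⁱ {k} i

data Tree (k n : ℕ) : Set where
  leaf : Tree k n
  node : Fin n → (𝔽 k → Tree k n) → Tree k n

maxBy : ∀ {n} → (Fin n → ℕ) → Fin n → List (Fin n) → Fin n
maxBy g x []       = x
maxBy g x (y ∷ ys) = if g x <ᵇ g y then maxBy g y ys else maxBy g x ys

-- Max-tree of the sub-d-permutation consisting of the points in S
-- (nodes labelled by the original points; relabelling preserves directions
-- and the order of last coordinates).  The fuel argument bounds the depth;
-- it is only ever used with fuel n ≥ |S|, which suffices since every level
-- removes the current maximum.
buildTree : ∀ {k n} → DPerm k n → ℕ → List (Fin n) → Tree k n
buildTree π zero    S        = leaf
buildTree π (suc m) []       = leaf
buildTree {k} π (suc m) (x ∷ xs) =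
  node p λ f → buildTree π m
    (filter (λ q → ¬? (p ≟ q) ×-dec VecP.≡-dec SignP._≟_ (dir π p q) (proj₁ f)) (x ∷ xs))
  where
  p = maxBy (λ q → toℕ (coord π (fromℕ k) q)) x xs

maxTree : ∀ {k n} → DPerm k n → Tree k n
maxTree {n = n} π = buildTree π n (allFin n)

data _∈T_ {k n : ℕ} (p : Fin n) : Tree k n → Set where
  here  : ∀ {ch} → p ∈T node p ch
  there : ∀ {q ch} (f : 𝔽 k) → p ∈T ch f → p ∈T node q ch

data _⊑_ {k n : ℕ} (s : Tree k n) : Tree k n → Set where
  refl⊑  : s ⊑ s
  child⊑ : ∀ {q ch} (f : 𝔽 k) → s ⊑ ch f → s ⊑ node q ch

dirⁱ∈𝔽 : ∀ {k} (i : Fin (suc k)) → last (dirⁱ {k} i) ≡ -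
dirⁱ∈𝔽 {k} i = lemma k i
  where
  open import Data.Vec.Properties using (tabulate-cong)
  open import Relation.Binary.PropositionalEquality using (refl; cong)
  lemma : ∀ k (i : Fin (suc k)) → last (dirⁱ {k} i) ≡ -
  lemma zero    zero    = refl
  lemma (suc k) zero    = lemma k zero
  lemma (suc k) (suc i) = lemma k i

dirF : ∀ {k} → Fin (suc k) → 𝔽 k
dirF i = dirⁱ i , dirⁱ∈𝔽 i

Admissible : ∀ {k n} → DPerm k n → Set
Admissible {k} {n} π =
  (∀ (q : Fin n) (ch : 𝔽 k → Tree k n) → node q ch ⊑ maxTree π →
     ∀ (l i j : Fin (suc k)) → i <ᶠ j → ∀ (a b : Fin n) →
     a ∈T ch (dirF i) → b ∈T ch (dirF j) →
     toℕ (coord π l a) < toℕ (coord π l b))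
  ×
  (¬ (∃[ q₂ ] ∃[ ch₂ ] (node q₂ ch₂ ⊑ maxTree π) ×
       ∃[ f ] (¬ InF (proj₁ f)) ×
       ∃[ q₁ ] ∃[ ch₁ ] (node q₁ ch₁ ⊑ ch₂ f)))

Contains2112 : ∀ {k n} → DPerm k n → Set
Contains2112 {k} {n} π =
  ∃[ p ] ∃[ q ] ∃[ i ] ∃[ j ] ∃[ l ] (i <ᶠ j) × (j <ᶠ l) ×
    (toℕ (coord π i p) < toℕ (coord π i q)) ×
    (toℕ (coord π j q) < toℕ (coord π j p)) ×
    (toℕ (coord π l p) < toℕ (coord π l q))

Contains231 : ∀ {k n} → DPerm k n → Set
Contains231 {k} {n} π =
  ∃[ i ] ∃[ j ] (i <ᶠ j) × ∃[ a ] ∃[ b ] ∃[ c ]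
    (toℕ (coord π i a) < toℕ (coord π i b)) ×
    (toℕ (coord π i b) < toℕ (coord π i c)) ×
    (toℕ (coord π j c) < toℕ (coord π j a)) ×
    (toℕ (coord π j a) < toℕ (coord π j b))

{-# OPTIONS --safe #-}
-- A point a in the subtree of a node q labelled f satisfies dir(q, a) = f.
-- Avoiding (21,12) forces every sign vector dir(q, a) with last entry − to be
-- of the form +⋯+−⋯−, which is condition (ii).  For (i), let a lie below
-- dir^i and b below dir^j with i < j.  Then a < q < b in coordinate i, and
-- also in every coordinate from i to j.  In a coordinate l outside that range
-- where b < a, the points q, b, a (if l < i) or a, q, b (if l ≥ j) form a 231
-- between coordinates l and i.
module Submission where

open import Defs
open import Data.Bool using (Bool; true; false; if_then_else_; T)
open import Data.Empty using (⊥-elim)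
open import Data.Fin using (Fin; zero; suc; toℕ; fromℕ; _≟_)
  renaming (_<_ to _<ᶠ_; _≤_ to _≤ᶠ_)
open import Data.Fin.Properties using (toℕ-injective; ≤fromℕ; ≤∧≢⇒<)
open import Data.List using (List; []; _∷_; allFin)
open import Data.List.Membership.Propositional using (_∈_)
open import Data.List.Membership.Propositional.Properties using (∈-filter⁻)
open import Data.List.Relation.Unary.Any using (here; there)
open import Data.Nat using (ℕ; _≤_; zero; suc; _<_; _<ᵇ_; _<?_; z<s; s<s)
open import Data.Nat.Properties using (<ᵇ⇒<; <⇒<ᵇ; ≮⇒≥; ≤⇒≯; <-asym; <-trans; <-≤-trans)
import Data.Nat.Properties as ℕ
open import Data.Product using (Σ-syntax; ∃-syntax; _×_; _,_; proj₁; proj₂)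
open import Data.Sign using (Sign; +; -)
import Data.Sign.Properties as SignP
open import Data.Unit using (tt)
open import Data.Vec using (tabulate; last; lookup)
open import Data.Vec.Properties using (lookup∘tabulate; tabulate-cong; ≡-dec)
open import Function using (_∘_)
open import Function.Bundles using (Injection)
open import Function.Properties.Inverse using (↔⇒↣)
open import Relation.Nullary using (¬_; Dec; yes; no; _×-dec_; contradiction)
open import Relation.Nullary.Decidable using (¬?)
open import Relation.Binary.PropositionalEquality
  using (_≡_; _≢_; refl; sym; trans; cong; subst; module ≡-Reasoning)

sign : Bool → Sign
sign b = if b then + else -

sign-injective : ∀ {b c} → sign b ≡ sign c → b ≡ c
sign-injective {true}  {true}  _ = refl
sign-injective {false} {false} _ = refl
sign-injective {true}  {false} ()
sign-injective {false} {true}  ()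

last-tabulate : ∀ {A : Set} k (g : Fin (suc k) → A) → last (tabulate g) ≡ g (fromℕ k)
last-tabulate zero    g = refl
last-tabulate (suc k) g = last-tabulate k (g ∘ suc)

<ᵇ-transfer : ∀ {m n m′ n′} → (m <ᵇ n) ≡ (m′ <ᵇ n′) → m′ < n′ → m < n
<ᵇ-transfer {m} {n} e m′<n′ = <ᵇ⇒< m n (subst T (sym e) (<⇒<ᵇ m′<n′))

antitone⇒initialSegment : ∀ {k} (s : Fin (suc k) → Bool) →
  (∀ {l m} → l <ᶠ m → s l ≡ false → s m ≡ false) → s (fromℕ k) ≡ false →
  Σ[ i ∈ Fin (suc k) ] ∀ l → s l ≡ (toℕ l <ᵇ toℕ i)
antitone⇒initialSegment {zero} s _ s-last = zero , λ { zero → s-last }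
antitone⇒initialSegment {suc k} s antitone s-last with s zero in s₀
... | false = zero , λ { zero → s₀ ; (suc l) → antitone z<s s₀ }
... | true with antitone⇒initialSegment (s ∘ suc) (antitone ∘ s<s) s-last
...   | i , s∘suc≡ = suc i , λ { zero → s₀ ; (suc l) → s∘suc≡ l }

maxBy-∈ : ∀ {n} (g : Fin n → ℕ) x xs → maxBy g x xs ∈ x ∷ xs
maxBy-∈ g x []       = here refl
maxBy-∈ g x (y ∷ ys) with g x <ᵇ g y
... | true  = there (maxBy-∈ g y ys)
... | false with maxBy-∈ g x ys
...   | here  e = here e
...   | there h = there (there h)

⊑⇒∈T : ∀ {k n} {q : Fin n} {ch : 𝔽 k → Tree k n} {t} → node q ch ⊑ t → q ∈T t
⊑⇒∈T refl⊑         = here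
⊑⇒∈T (child⊑ f q⊑) = there f (⊑⇒∈T q⊑)

module _ {k n : ℕ} (π : DPerm k n) where

  _<[_]_ : Fin n → Fin (suc k) → Fin n → Set
  p <[ l ] q = toℕ (coord π l p) < toℕ (coord π l q)

  -- By definition, dir π p q = tabulate (sign ∘ above p q)
  -- and dirⁱ i = tabulate (λ l → sign (toℕ l <ᵇ toℕ i)).
  above : Fin n → Fin n → Fin (suc k) → Bool
  above p q l = toℕ (coord π l p) <ᵇ toℕ (coord π l q)

  coord-injective : ∀ l {p q} → coord π l p ≡ coord π l q → p ≡ q
  coord-injective zero    e = e
  coord-injective (suc l) e = Injection.injective (↔⇒↣ (π l)) e

  <[]-connex : ∀ l {p q} → p ≢ q → ¬ p <[ l ] q → q <[ l ] p
  <[]-connex l p≢q p≮q =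
    ℕ.≤∧≢⇒< (≮⇒≥ p≮q) (λ e → p≢q (sym (coord-injective l (toℕ-injective e))))

  above-true : ∀ l {p q} → above p q l ≡ true → p <[ l ] q
  above-true l e = <ᵇ⇒< _ _ (subst T (sym e) tt)

  above-false : ∀ l {p q} → p ≢ q → above p q l ≡ false → q <[ l ] p
  above-false l p≢q e = <[]-connex l p≢q (λ p<q → subst T e (<⇒<ᵇ p<q))

  dir≡dirⁱ⇒ : ∀ {p q i} → p ≢ q → dir π p q ≡ dirⁱ i →
    ∀ l → (l <ᶠ i → p <[ l ] q) × (i ≤ᶠ l → q <[ l ] p)
  dir≡dirⁱ⇒ {p} {q} {i} p≢q e l =
    <ᵇ-transfer bits , λ i≤l → <[]-connex l p≢q (≤⇒≯ i≤l ∘ <ᵇ-transfer (sym bits))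
    where
    open ≡-Reasoning
    bits : above p q l ≡ (toℕ l <ᵇ toℕ i)
    bits = sign-injective (begin
      sign (above p q l)    ≡⟨ lookup∘tabulate (sign ∘ above p q) l ⟨
      lookup (dir π p q) l  ≡⟨ cong (λ v → lookup v l) e ⟩
      lookup (dirⁱ i) l     ≡⟨ lookup∘tabulate (λ l → sign (toℕ l <ᵇ toℕ i)) l ⟩
      sign (toℕ l <ᵇ toℕ i) ∎)

  maxPoint : Fin n → List (Fin n) → Fin n
  maxPoint = maxBy (λ q → toℕ (coord π (fromℕ k) q))

  inChild? : ∀ p (f : 𝔽 k) q → Dec (p ≢ q × dir π p q ≡ proj₁ f)
  inChild? p f q = ¬? (p ≟ q) ×-dec ≡-dec SignP._≟_ (dir π p q) (proj₁ f)

  ∈T-buildTree⇒∈ : ∀ m L {a} → a ∈T buildTree π m L → a ∈ L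
  ∈T-buildTree⇒∈ (suc m) (x ∷ xs) here        = maxBy-∈ _ x xs
  ∈T-buildTree⇒∈ (suc m) (x ∷ xs) (there f a∈) =
    proj₁ (∈-filter⁻ (inChild? (maxPoint x xs) f) (∈T-buildTree⇒∈ m _ a∈))

  ⊑-buildTree⇒dir : ∀ m L {q ch} → node q ch ⊑ buildTree π m L →
    ∀ {f a} → a ∈T ch f → q ≢ a × dir π q a ≡ proj₁ f
  ⊑-buildTree⇒dir (suc m) (x ∷ xs) refl⊑ {f} a∈ =
    proj₂ (∈-filter⁻ (inChild? (maxPoint x xs) f) (∈T-buildTree⇒∈ m _ a∈))
  ⊑-buildTree⇒dir (suc m) (x ∷ xs) (child⊑ _ q⊑) = ⊑-buildTree⇒dir m _ q⊑

  -- Once a coordinate of dir(p,q) is −, all later ones are −: a + in between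
  -- would give a (21,12) on q, p together with the last coordinate.
  no2112⇒dir∈F : ¬ Contains2112 π → ∀ {p q} → p ≢ q → last (dir π p q) ≡ - →
    InF (dir π p q)
  no2112⇒dir∈F no2112 {p} {q} p≢q last≡- =
    proj₁ segment , tabulate-cong (cong sign ∘ proj₂ segment)
    where
    s-last : above p q (fromℕ k) ≡ false
    s-last = sign-injective (trans (sym (last-tabulate k (sign ∘ above p q))) last≡-)
    antitone : ∀ {l m} → l <ᶠ m → above p q l ≡ false → above p q m ≡ false
    antitone {l} {m} l<m sₗ with above p q m in sₘ
    ... | false = refl
    ... | true  = ⊥-elim (no2112 (q , p , l , m , fromℕ k , l<m , m<last ,
                    above-false l p≢q sₗ , above-true m sₘ , above-false (fromℕ k) p≢q s-last))
      where
      m<last : m <ᶠ fromℕ k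
      m<last = ≤∧≢⇒< (≤fromℕ m) λ { refl → contradiction (trans (sym sₘ) s-last) λ () }
    segment : Σ[ i ∈ Fin (suc k) ] ∀ l → above p q l ≡ (toℕ l <ᵇ toℕ i)
    segment = antitone⇒initialSegment (above p q) antitone s-last

  no231⇒separated : ¬ Contains231 π → ∀ {q a b i j} → q ≢ a → q ≢ b →
    dir π q a ≡ dirⁱ i → dir π q b ≡ dirⁱ j → i <ᶠ j → ∀ l → a <[ l ] b
  no231⇒separated no231 {q} {a} {b} {i} {j} q≢a q≢b qa qb i<j = separated
    where
    A : ∀ l → (l <ᶠ i → q <[ l ] a) × (i ≤ᶠ l → a <[ l ] q)
    A = dir≡dirⁱ⇒ q≢a qa
    B : ∀ l → (l <ᶠ j → q <[ l ] b) × (j ≤ᶠ l → b <[ l ] q)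
    B = dir≡dirⁱ⇒ q≢b qb
    a<ᵢq : a <[ i ] q
    a<ᵢq = proj₂ (A i) ℕ.≤-refl
    q<ᵢb : q <[ i ] b
    q<ᵢb = proj₁ (B i) i<j
    b≢a : b ≢ a
    b≢a refl = <-asym a<ᵢq q<ᵢb
    separated : ∀ l → a <[ l ] b
    separated l with toℕ l <? toℕ i
    ... | yes l<i = <[]-connex l b≢a λ b<a →
            no231 (l , i , l<i , q , b , a , proj₁ (B l) (<-trans l<i i<j) , b<a , a<ᵢq , q<ᵢb)
    ... | no l≮i with toℕ l <? toℕ j
    ...   | yes l<j = <-trans (proj₂ (A l) (≮⇒≥ l≮i)) (proj₁ (B l) l<j)
    ...   | no l≮j  = <[]-connex l b≢a λ b<a →
            no231 (i , l , <-≤-trans i<j (≮⇒≥ l≮j) , a , q , b , a<ᵢq , q<ᵢb , b<a , proj₂ (A l) (≮⇒≥ l≮i))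

  no231⇒childrenSeparated : ¬ Contains231 π →
    ∀ q ch → node q ch ⊑ maxTree π → ∀ l i j → i <ᶠ j →
    ∀ a b → a ∈T ch (dirF i) → b ∈T ch (dirF j) → a <[ l ] b
  no231⇒childrenSeparated no231 q ch q⊑ l i j i<j a b a∈ b∈
    with ⊑-buildTree⇒dir n (allFin n) q⊑ a∈ | ⊑-buildTree⇒dir n (allFin n) q⊑ b∈
  ... | q≢a , qa | q≢b , qb = no231⇒separated no231 q≢a q≢b qa qb i<j l

  no2112⇒descendantsInF : ¬ Contains2112 π →
    ¬ (∃[ q₂ ] ∃[ ch₂ ] (node q₂ ch₂ ⊑ maxTree π) ×
       ∃[ f ] (¬ InF (proj₁ f)) ×
       ∃[ q₁ ] ∃[ ch₁ ] (node q₁ ch₁ ⊑ ch₂ f))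
  no2112⇒descendantsInF no2112 (q₂ , ch₂ , q₂⊑ , f , f∉F , q₁ , ch₁ , q₁⊑)
    with ⊑-buildTree⇒dir n (allFin n) q₂⊑ (⊑⇒∈T q₁⊑)
  ... | q₂≢q₁ , q₂q₁ =
    f∉F (subst InF q₂q₁ (no2112⇒dir∈F no2112 q₂≢q₁ (trans (cong last q₂q₁) (proj₂ f))))

proposition1 : (k n : ℕ) → 1 ≤ k → (π : DPerm k n) →
    ¬ Contains2112 π → ¬ Contains231 π → Admissible π
proposition1 k n _ π no2112 no231 =
  no231⇒childrenSeparated π no231 , no2112⇒descendantsInF π no2112
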